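{- Let $\ell \in \mathbb{N}$, let $G$ be a graph that is $k$-contractible to a graph $T \in \mathbb{T}_\ell$, and let $\mathcal{W}$ be the corresponding $T$-witness structure of $G$. Let $X, U \subseteq V(G)$ be such that $U$ is an independent set in $G$ and $X \subseteq N(v)$ for every $v \in U$. If $|U| \ge k + \ell + 2$, then there is a vertex $t \in V(T)$ such that $X \subseteq W(t)$.
   Context: All graphs are finite and simple. For $\ell \in \mathbb{N}$, $\mathbb{T}_\ell$ is the class of graphs from which a tree can be obtained by deleting at most $\ell$ edges. $G$ is $k$-contractible to $T$ if $G/S$ is isomorphic to $T$ for some $S \subseteq E(G)$ with $|S| \le k$, where $G/S$ is obtained by contracting all edges of $S$. The $T$-witness structure is the partition $\{W(t) : t \in V(T)\}$ of $V(G)$, where $W(t)$ is the set of vertices of $G$ merged into $t$; each $G[W(t)]$ is connected and $tt' \in E(T)$ iff some edge of $G$ joins $W(t)$ and $W(t')$. -}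

module Defs where

open import Data.Nat using (ℕ; _≤_; _+_)
open import Data.Fin using (Fin)
open import Data.Product using (_×_; Σ; ∃; ∃-syntax; _,_)
open import Data.Sum using (_⊎_)
open import Data.List using (List; length)
open import Data.List.Membership.Propositional using (_∈_)
open import Data.List.Relation.Unary.All using (All)
open import Data.List.Relation.Unary.Unique.Propositional using (Unique)
open import Relation.Binary.PropositionalEquality using (_≡_; _≢_)
open import Relation.Binary.Construct.Closure.ReflexiveTransitive using (Star)
open import Relation.Nullary using (¬_)
open import Function.Bundles using (_⇔_)

record Graph (n : ℕ) : Set₁ where
  field
    Adj    : Fin n → Fin n → Set
    sym    : ∀ {u v} → Adj u v → Adj v u
    irrefl : ∀ {u} → ¬ Adj u u
open Graph public

-- Edge sets are given as lists of (ordered representatives of) vertex pairs.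
EdgeList : ℕ → Set
EdgeList n = List (Fin n × Fin n)

InEdges : ∀ {n} → EdgeList n → Fin n → Fin n → Set
InEdges F u v = ((u , v) ∈ F) ⊎ ((v , u) ∈ F)

EdgesOf : ∀ {n} → Graph n → EdgeList n → Set
EdgesOf G F = All (λ e → Adj G (Data.Product.proj₁ e) (Data.Product.proj₂ e)) F

Connected : ∀ {n} → Graph n → Set
Connected {n} G = ∀ (u v : Fin n) → Star (Adj G) u v

data Path {n} (G : Graph n) : Fin n → List (Fin n) → Fin n → Set where
  single : ∀ v → Path G v (v Data.List.∷ Data.List.[]) v
  step   : ∀ {u v w vs} → Adj G u v → Path G v vs w → Path G u (u Data.List.∷ vs) w

HasCycle : ∀ {n} → Graph n → Set
HasCycle {n} G = Σ (List (Fin n)) λ vs → Σ (Fin n) λ a → Σ (Fin n) λ b →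
  Path G a vs b × Unique vs × (3 ≤ length vs) × Adj G b a

IsTree : ∀ {n} → Graph n → Set
IsTree G = Connected G × ¬ HasCycle G

deleteEdges : ∀ {n} → Graph n → EdgeList n → Graph n
deleteEdges G F = record
  { Adj = λ u v → Adj G u v × ¬ InEdges F u v
  ; sym = λ { (a , nf) → sym G a , λ { (Data.Sum.inj₁ x) → nf (Data.Sum.inj₂ x)
                                      ; (Data.Sum.inj₂ x) → nf (Data.Sum.inj₁ x) } }
  ; irrefl = λ { (a , _) → irrefl G a }
  }

InTℓ : ∀ {m} → ℕ → Graph m → Set
InTℓ ℓ T = ∃[ F ] (length F ≤ ℓ × EdgesOf T F × IsTree (deleteEdges T F))

-- G/S ≅ T, with w the witness map (W(t) = w⁻¹(t)):
-- * S is a set of at most k edges of G;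
-- * the vertices of G/S are the components of (V(G), S); w identifies exactly
--   the vertices in the same component, and is onto V(T) (so it induces a
--   bijection V(G/S) → V(T));
-- * two distinct classes are adjacent in T iff some edge of G joins them.
IsContraction : ∀ {n m} → ℕ → Graph n → Graph m → EdgeList n → (Fin n → Fin m) → Set
IsContraction {n} {m} k G T S w =
  (length S ≤ k) × EdgesOf G S ×
  (∀ (t : Fin m) → ∃[ u ] (w u ≡ t)) ×
  (∀ (u v : Fin n) → (w u ≡ w v) ⇔ Star (InEdges S) u v) ×
  (∀ (t t' : Fin m) → Adj T t t' ⇔
     (t ≢ t' × ∃[ u ] ∃[ v ] (w u ≡ t × w v ≡ t' × Adj G u v)))

module Submission where

-- Suppose two vertices x₁, x₂ of X lie in different bags
-- t₁ = w x₁ and t₂ = w x₂.  The list x₁ ∷ x₂ ∷ U has |U| + 2 distinct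
-- vertices, and contracting the at most k edges of S merges them into at
-- least |U| + 2 - k bags.  Discarding the bags t₁ and t₂ leaves at least
-- |U| - k ≥ ℓ + 2 bags, each containing a vertex of U; as every vertex of U
-- is adjacent to x₁ and x₂, each of these bags is a common neighbour of t₁
-- and t₂ in T.  But T minus at most ℓ edges F is a tree: every edge of F
-- destroys at most one common neighbour, and two distinct vertices of an
-- acyclic graph have at most one common neighbour (two of them span a
-- 4-cycle), so t₁ and t₂ have at most ℓ + 1 common neighbours in T.

open import Defs
open import Data.Nat using (ℕ; _≤_; _+_)
open import Data.Fin using (Fin)
open import Data.Fin.Subset using (Subset; _∈_; ∣_∣)
open import Data.Product using (_×_; ∃; ∃-syntax)
open import Relation.Binary.PropositionalEquality using (_≡_)
open import Relation.Nullary using (¬_)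

open import Data.Nat using (suc; z≤n; s≤s)
open import Data.Nat.Properties
  using (≤-refl; ≤-reflexive; ≤-trans; <-irrefl; n<1+n; +-suc; +-comm; +-identityʳ;
         +-monoˡ-≤; +-monoʳ-≤; +-cancelˡ-≤; m≤n+m; module ≤-Reasoning)
open import Data.Nat.Tactic.RingSolver using (solve-∀)
open import Data.Fin using (zero; suc; _≟_)
open import Data.Fin.Properties using (suc-injective; any?)
open import Data.Fin.Subset using (Nonempty; inside; outside)
open import Data.Fin.Subset.Properties using (_∈?_)
open import Data.Product using (_,_; proj₁; proj₂)
open import Data.Sum using (_⊎_; inj₁; inj₂)
open import Data.Empty using (⊥; ⊥-elim)
open import Data.List using (List; []; _∷_; length; map; filter)
open import Data.List.Properties using (length-map; filter-all)
open import Data.List.Membership.Propositional renaming (_∈_ to _∈ˡ_)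
open import Data.List.Membership.Propositional.Properties using (∈-map⁻; ∈-filter⁻)
open import Data.List.Relation.Binary.Subset.Propositional using (_⊆_)
open import Data.List.Relation.Unary.Any using (here; there)
open import Data.List.Relation.Unary.All as All using (All; []; _∷_)
open import Data.List.Relation.Unary.All.Properties using (all-filter; ¬Any⇒All¬)
import Data.List.Relation.Unary.All.Properties as Allₚ
open import Data.List.Relation.Unary.AllPairs as AllPairs using (AllPairs; []; _∷_)
import Data.List.Relation.Unary.AllPairs.Properties as AllPairsₚ
open import Data.List.Relation.Unary.Unique.Propositional using (Unique)
import Data.Vec as Vec
open import Relation.Binary.PropositionalEquality using (_≢_; refl; trans; cong)
  renaming (sym to ≡-sym)
open import Relation.Binary.Construct.Closure.ReflexiveTransitive using (Star; ε; _◅_)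
open import Relation.Nullary using (Dec; yes; no; ¬?)
open import Relation.Nullary.Decidable using (_×-dec_; _⊎-dec_)
open import Relation.Unary using (Decidable)
open import Function using (_∘_; id)
open import Function.Bundles using (Equivalence)

allPairs-strengthen : ∀ {A : Set} {Q : A → Set} {R R′ : A → A → Set} →
  (∀ {x y} → Q x → Q y → R x y → R′ x y) →
  ∀ {L} → All Q L → AllPairs R L → AllPairs R′ L
allPairs-strengthen f [] [] = []
allPairs-strengthen f (qx ∷ qs) (rx ∷ rs) =
  All.zipWith (λ (qy , r) → f qx qy r) (qs , rx) ∷ allPairs-strengthen f qs rs

AtMostOne : {A : Set} → (A → Set) → List A → Set
AtMostOne P = AllPairs (λ x y → ¬ (P x × P y))

filter-atMostOne : ∀ {A : Set} {P : A → Set} (P? : Decidable P) {L : List A} →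
  AtMostOne P L → length L ≤ suc (length (filter (¬? ∘ P?) L))
filter-atMostOne P? [] = z≤n
filter-atMostOne {P = P} P? {x ∷ xs} (x-excl ∷ rest) with P? x
... | yes px = s≤s (≤-reflexive (cong length (≡-sym (filter-all (¬? ∘ P?) others))))
  where
    others : All (λ y → ¬ P y) xs
    others = All.map (λ ¬both py → ¬both (px , py)) x-excl
... | no _ = s≤s (filter-atMostOne P? rest)

-- A duplicate-free list contains a given value at most once.
drop-value : ∀ {m} (t : Fin m) {L : List (Fin m)} → Unique L →
  length L ≤ suc (length (filter (¬? ∘ (_≟ t)) L))
drop-value t unique =
  filter-atMostOne (_≟ t) (AllPairs.map (λ x≢y (x≡t , y≡t) → x≢y (trans x≡t (≡-sym y≡t))) unique)

map-suc-unique : ∀ {n} {xs : List (Fin n)} → Unique xs → Unique (map suc xs)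
map-suc-unique unique = AllPairsₚ.map⁺ (AllPairs.map (λ x≢y → x≢y ∘ suc-injective) unique)

elements : ∀ {n} → Subset n → List (Fin n)
elements Vec.[] = []
elements (inside Vec.∷ p) = zero ∷ map suc (elements p)
elements (outside Vec.∷ p) = map suc (elements p)

elements-length : ∀ {n} (p : Subset n) → ∣ p ∣ ≡ length (elements p)
elements-length Vec.[] = refl
elements-length (inside Vec.∷ p) =
  cong suc (trans (elements-length p) (≡-sym (length-map suc (elements p))))
elements-length (outside Vec.∷ p) =
  trans (elements-length p) (≡-sym (length-map suc (elements p)))

elements-sound : ∀ {n} (p : Subset n) {x} → x ∈ˡ elements p → x ∈ p
elements-sound (inside Vec.∷ p) (here refl) = Vec.here
elements-sound (inside Vec.∷ p) (there x∈) with ∈-map⁻ suc x∈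
... | _ , x∈p , refl = Vec.there (elements-sound p x∈p)
elements-sound (outside Vec.∷ p) x∈ with ∈-map⁻ suc x∈
... | _ , x∈p , refl = Vec.there (elements-sound p x∈p)

elements-unique : ∀ {n} (p : Subset n) → Unique (elements p)
elements-unique Vec.[] = []
elements-unique (inside Vec.∷ p) =
  Allₚ.map⁺ (All.universal (λ _ ()) (elements p)) ∷ map-suc-unique (elements-unique p)
elements-unique (outside Vec.∷ p) = map-suc-unique (elements-unique p)

nonempty : ∀ {n} (p : Subset n) → 1 ≤ ∣ p ∣ → Nonempty p
nonempty p size with elements p | elements-length p | elements-sound p
... | x ∷ _ | _ | sound = x , sound (here refl)
... | [] | size≡0 | _ with () ← ≤-trans size (≤-reflexive size≡0)

-- Either w is constant on X (taking the value default when X is empty), or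
-- two members of X have different images.
oneFibreOrSplit : ∀ {n m} (w : Fin n → Fin m) (X : Subset n) → Fin m →
  ∃[ t ] (∀ x → x ∈ X → w x ≡ t) ⊎
  ∃[ x₁ ] ∃[ x₂ ] (x₁ ∈ X × x₂ ∈ X × w x₁ ≢ w x₂)
oneFibreOrSplit w X default
  with any? (λ x₁ → any? (λ x₂ → (x₁ ∈? X) ×-dec ((x₂ ∈? X) ×-dec ¬? (w x₁ ≟ w x₂))))
... | yes split = inj₂ split
... | no noSplit with any? (_∈? X)
...   | no empty = inj₁ (default , λ x x∈X → ⊥-elim (empty (x , x∈X)))
...   | yes (x₀ , x₀∈X) = inj₁ (w x₀ , sameFibre)
  where
    sameFibre : ∀ x → x ∈ X → w x ≡ w x₀
    sameFibre x x∈X with w x ≟ w x₀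
    ... | yes same = same
    ... | no differ = ⊥-elim (noSplit (x , x₀ , x∈X , x₀∈X , differ))

-- The bags of a contraction are counted through an explicit labelling:
-- classOf S assigns to each vertex a representative of its component in
-- (V(G), S); each edge of S relabels one class into another.
relabel : ∀ {n} → Fin n → Fin n → Fin n → Fin n
relabel x y v with v ≟ x
... | yes _ = y
... | no _ = v

relabel-source : ∀ {n} (x y : Fin n) → relabel x y x ≡ y
relabel-source x y with x ≟ x
... | yes _ = refl
... | no x≢x = ⊥-elim (x≢x refl)

relabel-target : ∀ {n} (x y : Fin n) → relabel x y y ≡ y
relabel-target x y with y ≟ x
... | yes _ = refl
... | no _ = refl

relabel-other : ∀ {n} (x y v : Fin n) → v ≢ x → relabel x y v ≡ v
relabel-other x y v v≢x with v ≟ x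
... | yes v≡x = ⊥-elim (v≢x v≡x)
... | no _ = refl

classOf : ∀ {n} → EdgeList n → Fin n → Fin n
classOf [] v = v
classOf ((a , b) ∷ S) v = relabel (classOf S a) (classOf S b) (classOf S v)

classOf-edge : ∀ {n} (S : EdgeList n) {u v} → InEdges S u v → classOf S u ≡ classOf S v
classOf-edge ((a , b) ∷ S) (inj₁ (here refl)) =
  trans (relabel-source (classOf S a) (classOf S b)) (≡-sym (relabel-target (classOf S a) (classOf S b)))
classOf-edge ((a , b) ∷ S) (inj₂ (here refl)) =
  trans (relabel-target (classOf S a) (classOf S b)) (≡-sym (relabel-source (classOf S a) (classOf S b)))
classOf-edge ((a , b) ∷ S) (inj₁ (there e)) = cong (relabel _ _) (classOf-edge S (inj₁ e))
classOf-edge ((a , b) ∷ S) (inj₂ (there e)) = cong (relabel _ _) (classOf-edge S (inj₂ e))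

classOf-path : ∀ {n} (S : EdgeList n) {u v} → Star (InEdges S) u v → classOf S u ≡ classOf S v
classOf-path S ε = refl
classOf-path S (e ◅ p) = trans (classOf-edge S e) (classOf-path S p)

-- Each edge merges at most two classes, so a duplicate-free list A has a
-- sublist of pairwise differently labelled vertices missing at most |S| of A.
representatives : ∀ {n} (S : EdgeList n) (A : List (Fin n)) → Unique A →
  ∃[ B ] B ⊆ A × AllPairs (λ x y → classOf S x ≢ classOf S y) B × length A ≤ length B + length S
representatives [] A unique = A , id , unique , ≤-reflexive (≡-sym (+-identityʳ _))
representatives ((a , b) ∷ S) A unique with representatives S A unique
... | B , B⊆A , distinct , bound = filter keep? B , B⊆A ∘ proj₁ ∘ ∈-filter⁻ keep? , distinct′ , bound′
  where
    open ≤-Reasoning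
    c : Fin _ → Fin _
    c = classOf S
    inClass? : Decidable (λ x → c x ≡ c a)
    inClass? x = c x ≟ c a
    keep? : Decidable (λ x → ¬ c x ≡ c a)
    keep? = ¬? ∘ inClass?
    distinct′ : AllPairs (λ x y → relabel (c a) (c b) (c x) ≢ relabel (c a) (c b) (c y)) (filter keep? B)
    distinct′ = allPairs-strengthen
      (λ {x} {y} x-kept y-kept cx≢cy eq →
        cx≢cy (trans (≡-sym (relabel-other _ _ (c x) x-kept)) (trans eq (relabel-other _ _ (c y) y-kept))))
      (all-filter keep? B) (AllPairsₚ.filter⁺ keep? distinct)
    oneInClass : AtMostOne (λ x → c x ≡ c a) B
    oneInClass = AllPairs.map (λ cx≢cy (x≡ , y≡) → cx≢cy (trans x≡ (≡-sym y≡))) distinct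
    bound′ : length A ≤ length (filter keep? B) + suc (length S)
    bound′ = begin
      length A                              ≤⟨ bound ⟩
      length B + length S                   ≤⟨ +-monoˡ-≤ (length S) (filter-atMostOne inClass? oneInClass) ⟩
      suc (length (filter keep? B)) + length S ≡⟨ ≡-sym (+-suc _ (length S)) ⟩
      length (filter keep? B) + suc (length S) ∎

bagCount : ∀ {n m} (S : EdgeList n) (w : Fin n → Fin m) →
  (∀ u v → w u ≡ w v → Star (InEdges S) u v) →
  (A : List (Fin n)) → Unique A →
  ∃[ L ] Unique L × (∀ {t} → t ∈ˡ L → ∃[ a ] (a ∈ˡ A × t ≡ w a)) × length A ≤ length L + length S
bagCount S w same-bag⇒path A unique with representatives S A unique
... | B , B⊆A , distinct , bound = map w B , unique′ , images , bound′
  where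
    unique′ : Unique (map w B)
    unique′ = AllPairsₚ.map⁺ (AllPairs.map (λ {x} {y} cx≢cy wx≡wy →
      cx≢cy (classOf-path S (same-bag⇒path x y wx≡wy))) distinct)
    images : ∀ {t} → t ∈ˡ map w B → ∃[ a ] (a ∈ˡ A × t ≡ w a)
    images t∈ with ∈-map⁻ w t∈
    ... | a , a∈B , t≡wa = a , B⊆A a∈B , t≡wa
    bound′ : length A ≤ length (map w B) + length S
    bound′ = ≤-trans bound (≤-reflexive (cong (_+ length S) (≡-sym (length-map w B))))

module CommonNeighbours {m : ℕ} (t₁ t₂ : Fin m) where

  Hub : Fin m → Set
  Hub s = s ≡ t₁ ⊎ s ≡ t₂

  CommonNbr : Graph m → Fin m → Set
  CommonNbr H s = ¬ Hub s × Adj H t₁ s × Adj H t₂ s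

  dropHubs : {L : List (Fin m)} → Unique L →
    ∃[ L′ ] Unique L′ × (∀ {t} → t ∈ˡ L′ → t ∈ˡ L × ¬ Hub t) × length L ≤ 2 + length L′
  dropHubs {L} unique = L₂ , unique₂ , kept , bound
    where
      L₁ = filter (¬? ∘ (_≟ t₁)) L
      L₂ = filter (¬? ∘ (_≟ t₂)) L₁
      unique₁ : Unique L₁
      unique₁ = AllPairsₚ.filter⁺ (¬? ∘ (_≟ t₁)) unique
      unique₂ : Unique L₂
      unique₂ = AllPairsₚ.filter⁺ (¬? ∘ (_≟ t₂)) unique₁
      kept : ∀ {t} → t ∈ˡ L₂ → t ∈ˡ L × ¬ Hub t
      kept t∈ with ∈-filter⁻ (¬? ∘ (_≟ t₂)) t∈
      ... | t∈L₁ , t≢t₂ with ∈-filter⁻ (¬? ∘ (_≟ t₁)) t∈L₁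
      ...   | t∈L , t≢t₁ = t∈L , λ { (inj₁ t≡t₁) → t≢t₁ t≡t₁ ; (inj₂ t≡t₂) → t≢t₂ t≡t₂ }
      bound : length L ≤ 2 + length L₂
      bound = ≤-trans (drop-value t₁ unique) (s≤s (drop-value t₂ unique₁))

  -- Two distinct common neighbours of distinct hubs span the 4-cycle t₁ s t₂ s′.
  fourCycle : (H : Graph m) → t₁ ≢ t₂ → ∀ {s s′} → s ≢ s′ →
    CommonNbr H s → CommonNbr H s′ → HasCycle H
  fourCycle H t₁≢t₂ {s} {s′} s≢s′ (s-out , t₁s , t₂s) (s′-out , t₁s′ , t₂s′) =
    t₁ ∷ s ∷ t₂ ∷ s′ ∷ [] , t₁ , s′ , path , distinct , s≤s (s≤s (s≤s z≤n)) , Graph.sym H t₁s′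
    where
      path : Path H t₁ (t₁ ∷ s ∷ t₂ ∷ s′ ∷ []) s′
      path = step t₁s (step (Graph.sym H t₂s) (step t₂s′ (single s′)))
      distinct : Unique (t₁ ∷ s ∷ t₂ ∷ s′ ∷ [])
      distinct = ((λ e → s-out (inj₁ (≡-sym e))) ∷ t₁≢t₂ ∷ (λ e → s′-out (inj₁ (≡-sym e))) ∷ [])
               ∷ ((λ e → s-out (inj₂ e)) ∷ s≢s′ ∷ [])
               ∷ ((λ e → s′-out (inj₂ (≡-sym e))) ∷ [])
               ∷ [] ∷ []

  atMostOneCommonNbr : (H : Graph m) → ¬ HasCycle H → t₁ ≢ t₂ →
    {L : List (Fin m)} → Unique L → All (CommonNbr H) L → length L ≤ 1
  atMostOneCommonNbr H acyclic t₁≢t₂ [] [] = z≤n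
  atMostOneCommonNbr H acyclic t₁≢t₂ (_ ∷ []) (_ ∷ []) = ≤-refl
  atMostOneCommonNbr H acyclic t₁≢t₂ ((s≢s′ ∷ _) ∷ _) (c ∷ c′ ∷ _) =
    ⊥-elim (acyclic (fourCycle H t₁≢t₂ s≢s′ c c′))

  Cuts : Fin m × Fin m → Fin m → Set
  Cuts (a , b) s = (Hub a × b ≡ s) ⊎ (Hub b × a ≡ s)

  cuts? : ∀ e s → Dec (Cuts e s)
  cuts? (a , b) s = (hub? a ×-dec (b ≟ s)) ⊎-dec (hub? b ×-dec (a ≟ s))
    where hub? = λ x → (x ≟ t₁) ⊎-dec (x ≟ t₂)

  cuts-unique : ∀ {e s s′} → Cuts e s → Cuts e s′ → ¬ Hub s → ¬ Hub s′ → s ≡ s′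
  cuts-unique (inj₁ (_ , refl)) (inj₁ (_ , refl)) _ _ = refl
  cuts-unique (inj₂ (_ , refl)) (inj₂ (_ , refl)) _ _ = refl
  cuts-unique (inj₁ (a-hub , _)) (inj₂ (_ , refl)) _ s′-out = ⊥-elim (s′-out a-hub)
  cuts-unique (inj₂ (_ , refl)) (inj₁ (a-hub , _)) s-out _ = ⊥-elim (s-out a-hub)

  survives : ∀ e F {h s} → Hub h → ¬ Cuts e s → ¬ InEdges F h s → ¬ InEdges (e ∷ F) h s
  survives e F h-hub uncut kept (inj₁ (here refl)) = uncut (inj₁ (h-hub , refl))
  survives e F h-hub uncut kept (inj₂ (here refl)) = uncut (inj₂ (h-hub , refl))
  survives e F h-hub uncut kept (inj₁ (there e∈F)) = kept (inj₁ e∈F)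
  survives e F h-hub uncut kept (inj₂ (there e∈F)) = kept (inj₂ e∈F)

  surviving : (T : Graph m) (F : EdgeList m) {L : List (Fin m)} → Unique L → All (CommonNbr T) L →
    ∃[ L′ ] Unique L′ × All (CommonNbr (deleteEdges T F)) L′ × length L ≤ length F + length L′
  surviving T [] {L} unique common = L , unique , All.map keep common , ≤-refl
    where
      none : ∀ {u v} → ¬ InEdges [] u v
      none (inj₁ ())
      none (inj₂ ())
      keep : ∀ {s} → CommonNbr T s → CommonNbr (deleteEdges T []) s
      keep (s-out , t₁s , t₂s) = s-out , (t₁s , none) , (t₂s , none)
  surviving T (e ∷ F) {L} unique common with surviving T F unique common
  ... | L′ , unique′ , common′ , bound = filter uncut? L′ , unique″ , common″ , bound′
    where
      uncut? = ¬? ∘ cuts? e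
      unique″ : Unique (filter uncut? L′)
      unique″ = AllPairsₚ.filter⁺ uncut? unique′
      keep : ∀ {s} → ¬ Cuts e s × CommonNbr (deleteEdges T F) s → CommonNbr (deleteEdges T (e ∷ F)) s
      keep (uncut , s-out , (t₁s , t₁s-kept) , (t₂s , t₂s-kept)) =
        s-out , (t₁s , survives e F (inj₁ refl) uncut t₁s-kept) , (t₂s , survives e F (inj₂ refl) uncut t₂s-kept)
      common″ : All (CommonNbr (deleteEdges T (e ∷ F))) (filter uncut? L′)
      common″ = All.zipWith keep (all-filter uncut? L′ , Allₚ.filter⁺ uncut? common′)
      atMostOneCut : AtMostOne (Cuts e) L′
      atMostOneCut = allPairs-strengthen
        (λ c c′ s≢s′ (cut , cut′) → s≢s′ (cuts-unique cut cut′ (proj₁ c) (proj₁ c′))) common′ unique′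
      bound′ : length L ≤ suc (length F) + length (filter uncut? L′)
      bound′ = ≤-trans bound (≤-trans (+-monoʳ-≤ (length F) (filter-atMostOne (cuts? e) atMostOneCut))
                                      (≤-reflexive (+-suc (length F) _)))

  commonNbrBound : (T : Graph m) (F : EdgeList m) → ¬ HasCycle (deleteEdges T F) → t₁ ≢ t₂ →
    {L : List (Fin m)} → Unique L → All (CommonNbr T) L → length L ≤ suc (length F)
  commonNbrBound T F acyclic t₁≢t₂ unique common with surviving T F unique common
  ... | L′ , unique′ , common′ , bound =
    ≤-trans bound (≤-trans (+-monoʳ-≤ (length F) (atMostOneCommonNbr _ acyclic t₁≢t₂ unique′ common′))
                           (≤-reflexive (+-comm (length F) 1)))

-- The numeric core: at least |U| - k ≥ ℓ + 2 common neighbours versus at most ℓ + 1.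
counting-contradiction : ∀ k ℓ u c f → k + ℓ + 2 ≤ u → u ≤ c + k → c ≤ suc f → f ≤ ℓ → ⊥
counting-contradiction k ℓ u c f large bags common deleted = <-irrefl refl (begin-strict
  suc ℓ + k            <⟨ n<1+n _ ⟩
  suc (suc ℓ) + k      ≡⟨ rearrange k ℓ ⟩
  k + ℓ + 2            ≤⟨ large ⟩
  u                    ≤⟨ bags ⟩
  c + k                ≤⟨ +-monoˡ-≤ k (≤-trans common (s≤s deleted)) ⟩
  suc ℓ + k            ∎)
  where
    open ≤-Reasoning
    rearrange : ∀ k ℓ → suc (suc ℓ) + k ≡ k + ℓ + 2
    rearrange = solve-∀

-- A vertex adjacent to every member of U is not in U (G has no loops), so
-- two distinct such vertices followed by U form a duplicate-free list.
neighbours∷U-unique : ∀ {n} (G : Graph n) (X U : Subset n) →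
  (∀ v x → v ∈ U → x ∈ X → Adj G v x) →
  ∀ {x₁ x₂} → x₁ ∈ X → x₂ ∈ X → x₁ ≢ x₂ → Unique (x₁ ∷ x₂ ∷ elements U)
neighbours∷U-unique G X U X⊆N x₁∈X x₂∈X x₁≢x₂ =
  (x₁≢x₂ ∷ outsideU x₁∈X) ∷ outsideU x₂∈X ∷ elements-unique U
  where
    outsideU : ∀ {x} → x ∈ X → All (x ≢_) (elements U)
    outsideU {x} x∈X = ¬Any⇒All¬ _ (λ x∈U → Graph.irrefl G (X⊆N x x (elements-sound U x∈U) x∈X))

noSplitFibre : ∀ {n m : ℕ} (k ℓ : ℕ) (G : Graph n) (T : Graph m)
  (S : EdgeList n) (w : Fin n → Fin m) →
  InTℓ ℓ T → IsContraction k G T S w →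
  (X U : Subset n) → (∀ v x → v ∈ U → x ∈ X → Adj G v x) → k + ℓ + 2 ≤ ∣ U ∣ →
  ∀ {x₁ x₂} → x₁ ∈ X → x₂ ∈ X → w x₁ ≢ w x₂ → ⊥
noSplitFibre k ℓ G T S w (F , |F|≤ℓ , _ , _ , acyclic) (|S|≤k , _ , _ , same-bag , adjT) X U X⊆N large
  {x₁} {x₂} x₁∈X x₂∈X split
  with bagCount S w (λ u v → Equivalence.to (same-bag u v)) (x₁ ∷ x₂ ∷ elements U)
       (neighbours∷U-unique G X U X⊆N x₁∈X x₂∈X (split ∘ cong w))
... | L , uniqueL , images , |A|≤ with CommonNeighbours.dropHubs (w x₁) (w x₂) uniqueL
...   | L′ , uniqueL′ , kept , |L|≤ =
  counting-contradiction k ℓ ∣ U ∣ (length L′) (length F) large |U|≤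
    (commonNbrBound T F acyclic split uniqueL′ (All.tabulate (common ∘ kept))) |F|≤ℓ
  where
    open CommonNeighbours (w x₁) (w x₂)
    toT : ∀ {x v} → x ∈ X → v ∈ U → w x ≢ w v → Adj T (w x) (w v)
    toT {x} {v} x∈X v∈U differ =
      Equivalence.from (adjT (w x) (w v)) (differ , x , v , refl , refl , Graph.sym G (X⊆N v x v∈U x∈X))
    common : ∀ {t} → t ∈ˡ L × ¬ Hub t → CommonNbr T t
    common (t∈L , t-out) with images t∈L
    ... | _ , here refl , refl = ⊥-elim (t-out (inj₁ refl))
    ... | _ , there (here refl) , refl = ⊥-elim (t-out (inj₂ refl))
    ... | v , there (there v∈) , refl =
      t-out , toT x₁∈X v∈U (t-out ∘ inj₁ ∘ ≡-sym) , toT x₂∈X v∈U (t-out ∘ inj₂ ∘ ≡-sym)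
      where
        v∈U : v ∈ U
        v∈U = elements-sound U v∈
    |U|≤ : ∣ U ∣ ≤ length L′ + k
    |U|≤ = +-cancelˡ-≤ 2 _ _ (begin
      2 + ∣ U ∣                     ≡⟨ cong (2 +_) (elements-length U) ⟩
      length (x₁ ∷ x₂ ∷ elements U) ≤⟨ |A|≤ ⟩
      length L + length S           ≤⟨ +-monoˡ-≤ (length S) |L|≤ ⟩
      2 + length L′ + length S      ≤⟨ +-monoʳ-≤ (2 + length L′) |S|≤k ⟩
      2 + (length L′ + k)           ∎)
      where open ≤-Reasoning

-- Every vertex of X lies in a single bag.
mainTheorem14 : ∀ {n m : ℕ} (k ℓ : ℕ) (G : Graph n) (T : Graph m)
    (S : EdgeList n) (w : Fin n → Fin m) →
    InTℓ ℓ T →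
    IsContraction k G T S w →
    (X U : Subset n) →
    (∀ u v → u ∈ U → v ∈ U → ¬ Adj G u v) →
    (∀ v x → v ∈ U → x ∈ X → Adj G v x) →
    k + ℓ + 2 ≤ ∣ U ∣ →
    ∃[ t ] (∀ x → x ∈ X → w x ≡ t)
mainTheorem14 k ℓ G T S w nearTree contraction X U _ X⊆N large
  with oneFibreOrSplit w X (w (proj₁ (nonempty U (≤-trans (s≤s z≤n) (≤-trans (m≤n+m 2 (k + ℓ)) large)))))
... | inj₁ oneFibre = oneFibre
... | inj₂ (_ , _ , x₁∈X , x₂∈X , split) =
  ⊥-elim (noSplitFibre k ℓ G T S w nearTree contraction X U X⊆N large x₁∈X x₂∈X split)
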